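{- Let $G$ be a graph and let $C\subseteq V(G)$ be a reducible set of $G$. Then $\mathtt{opt}(G) = \mathtt{opt}(G-(N(C)\cup C)) + |N(C)|$.
   Context: All graphs are finite, undirected and simple; $P_2$ is the path on three vertices. $\mathtt{opt}(G)$ denotes the maximum number of pairwise vertex-disjoint $P_2$'s (as subgraphs) in $G$. For $U\subseteq V(G)$, $G[U]$ is the induced subgraph, $G-U=G[V(G)\setminus U]$, and $N(C)$ is the set of vertices outside $C$ adjacent to at least one vertex of $C$. A component is a maximal connected induced subgraph; an edge component is a component on exactly two vertices. A set $C\subseteq V(G)$ with $N(C)=\{v_1,\dots,v_\ell\}$ is a reducible set of $G$ if the maximum degree of $G[C]$ is at most one and one of the following holds: (i) there are $\ell$ edge components $C_1,\dots,C_\ell$ of $G[C]$ such that $v_i$ is adjacent to (some vertex of) $C_i$ for $1\le i\le \ell$; or (ii) there are $2\ell$ components $C_1,\dots,C_{2\ell}$ of $G[C]$ such that $v_i$ is adjacent to $C_{2i-1}$ and to $C_{2i}$ for $1\le i\le\ell$. -}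

module Defs where

open import Data.Nat using (ℕ; zero; suc; _+_; _≤_)
open import Data.Fin using (Fin; zero; suc)
open import Data.Bool using (Bool; true; false; _∧_; _∨_; not; if_then_else_)
open import Data.Product using (Σ; _×_; _,_; ∃)
open import Data.Sum using (_⊎_)
open import Data.Empty using (⊥)
open import Relation.Nullary using (¬_)
open import Relation.Binary.PropositionalEquality using (_≡_; _≢_)

record Graph (n : ℕ) : Set where
  field
    adj    : Fin n → Fin n → Bool
    sym    : ∀ u v → adj u v ≡ adj v u
    irrefl : ∀ v → adj v v ≡ false
open Graph public

VSet : ℕ → Set
VSet n = Fin n → Bool

anyFin : ∀ {n} → (Fin n → Bool) → Bool
anyFin {zero}  f = false
anyFin {suc n} f = f zero ∨ anyFin (λ i → f (suc i))

count : ∀ {n} → VSet n → ℕ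
count {zero}  S = 0
count {suc n} S = (if S zero then 1 else 0) + count (λ i → S (suc i))

nbhd : ∀ {n} → Graph n → VSet n → VSet n
nbhd G C v = not (C v) ∧ anyFin (λ u → C u ∧ adj G u v)

rest : ∀ {n} → Graph n → VSet n → VSet n
rest G C v = not (C v ∨ nbhd G C v)

-- A P₂ (path on three vertices x - y - z) as a subgraph of G[W]
record P2In {n : ℕ} (G : Graph n) (W : VSet n) : Set where
  field
    x y z : Fin n
    x≢y   : x ≢ y
    y≢z   : y ≢ z
    x≢z   : x ≢ z
    xy    : adj G x y ≡ true
    yz    : adj G y z ≡ true
    xW    : W x ≡ true
    yW    : W y ≡ true
    zW    : W z ≡ true
open P2In public

OnPath : ∀ {n} {G : Graph n} {W : VSet n} → P2In G W → Fin n → Set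
OnPath p u = (u ≡ x p) ⊎ (u ≡ y p) ⊎ (u ≡ z p)

Packing : ∀ {n} → Graph n → VSet n → ℕ → Set
Packing G W k =
  Σ (Fin k → P2In G W) λ p →
    ∀ i j → i ≢ j → ∀ u → OnPath (p i) u → OnPath (p j) u → ⊥

IsOpt : ∀ {n} → Graph n → VSet n → ℕ → Set
IsOpt G W m = Packing G W m × (∀ k → Packing G W k → k ≤ m)

data Reach {n : ℕ} (G : Graph n) (C : VSet n) : Fin n → Fin n → Set where
  here : ∀ {u} → C u ≡ true → Reach G C u u
  step : ∀ {u w v} → C u ≡ true → adj G u w ≡ true → Reach G C w v → Reach G C u v

EdgeComp : ∀ {n} → Graph n → VSet n → Fin n → Set
EdgeComp G C r = Σ (Fin _) λ a → Σ (Fin _) λ b → a ≢ b ×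
  (∀ w → Reach G C r w → (w ≡ a ⊎ w ≡ b)) × Reach G C r a × Reach G C r b

AdjComp : ∀ {n} → Graph n → VSet n → Fin n → Fin n → Set
AdjComp G C v r = ∃ λ w → Reach G C r w × adj G v w ≡ true

MaxDeg≤1 : ∀ {n} → Graph n → VSet n → Set
MaxDeg≤1 G C = ∀ v u w → C v ≡ true → C u ≡ true → C w ≡ true →
  adj G v u ≡ true → adj G v w ≡ true → u ≡ w

-- Components are given by representatives r ∈ C; two representatives give the
-- same component iff they are connected in G[C].
-- (i): to every v ∈ N(C) an edge component C_v adjacent to v, pairwise distinct
CondI : ∀ {n} → Graph n → VSet n → Set
CondI G C = Σ (Fin _ → Fin _) λ f →
  (∀ v → nbhd G C v ≡ true →
     C (f v) ≡ true × EdgeComp G C (f v) × AdjComp G C v (f v)) ×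
  (∀ v v' → nbhd G C v ≡ true → nbhd G C v' ≡ true → v ≢ v' →
     ¬ Reach G C (f v) (f v'))

CondII : ∀ {n} → Graph n → VSet n → Set
CondII G C = Σ (Fin _ → Fin _) λ f₁ → Σ (Fin _ → Fin _) λ f₂ →
  (∀ v → nbhd G C v ≡ true →
     C (f₁ v) ≡ true × C (f₂ v) ≡ true ×
     AdjComp G C v (f₁ v) × AdjComp G C v (f₂ v) ×
     ¬ Reach G C (f₁ v) (f₂ v)) ×
  (∀ v v' → nbhd G C v ≡ true → nbhd G C v' ≡ true → v ≢ v' →
     ¬ Reach G C (f₁ v) (f₁ v') × ¬ Reach G C (f₁ v) (f₂ v') ×
     ¬ Reach G C (f₂ v) (f₁ v') × ¬ Reach G C (f₂ v) (f₂ v'))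

Reducible : ∀ {n} → Graph n → VSet n → Set
Reducible G C = MaxDeg≤1 G C × (CondI G C ⊎ CondII G C)

allV : ∀ {n} → VSet n
allV _ = true

module Submission where

-- Since G[C] has maximum degree at most one, a P₂ of G that avoids N(C) avoids C as well: a vertex of C
-- on it would pull its path-neighbours into C, and three vertices of C on a path contradict the degree
-- bound. So in a packing of G at most |N(C)| paths meet N(C) and the others pack G − (N(C) ∪ C).
-- Conversely, (i) or (ii) gives every v ∈ N(C) a P₂ through v inside v and its own one or two components
-- of G[C]; these |N(C)| disjoint paths miss G − (N(C) ∪ C) and extend any packing of it.

open import Defs hiding (sym)
open import Data.Nat using (ℕ; zero; suc; _+_; _≤_)
open import Data.Nat.Properties using (+-suc; +-comm; +-monoˡ-≤; +-monoʳ-≤; ≤-trans; ≤-antisym; module ≤-Reasoning)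
open import Data.Fin using (Fin; zero; suc; splitAt; _≟_)
open import Data.Fin.Properties using (suc-injective; injective⇒≤; splitAt⁻¹-↑ˡ; splitAt⁻¹-↑ʳ)
open import Data.Vec.Functional using (_++_)
open import Data.Bool using (Bool; true; false; not; _∧_; _∨_; if_then_else_)
open import Data.Bool.Properties using (∨-zeroʳ; ¬-not)
open import Data.Product using (Σ; ∃; _×_; _,_; proj₁; proj₂)
open import Data.Sum using (_⊎_; inj₁; inj₂; [_,_]′)
open import Data.Empty using (⊥; ⊥-elim)
open import Function using (_∘_; const; case_of_)
open import Function.Definitions using (Injective)
open import Relation.Nullary using (¬_; yes; no)
open import Relation.Binary.PropositionalEquality using (_≡_; _≢_; refl; sym; trans; cong; cong₂; subst; module ≡-Reasoning)

record Enumeration {n} (T : VSet n) (k : ℕ) : Set where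
  field
    index           : Fin k → Fin n
    index-injective : Injective _≡_ _≡_ index
    index-∈         : ∀ j → T (index j) ≡ true
    index-onto      : ∀ v → T v ≡ true → ∃ λ j → index j ≡ v
open Enumeration

enumerate : ∀ {n} (T : VSet n) → Enumeration T (count T)
enumerate {zero} T = record
  { index = λ () ; index-injective = λ {} ; index-∈ = λ () ; index-onto = λ () }
enumerate {suc n} T = extend (T zero) refl (enumerate (T ∘ suc))
  where
  extend : ∀ {k} b → T zero ≡ b → Enumeration (T ∘ suc) k →
           Enumeration T ((if b then 1 else 0) + k)
  extend true t₀ E = record
    { index = index′ ; index-injective = injective ; index-∈ = ∈T ; index-onto = onto }
    where
    index′ : Fin (suc _) → Fin (suc n)
    index′ zero    = zero
    index′ (suc j) = suc (index E j)
    injective : Injective _≡_ _≡_ index′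
    injective {zero}  {zero}  _ = refl
    injective {zero}  {suc _} ()
    injective {suc _} {zero}  ()
    injective {suc i} {suc j} e = cong suc (index-injective E (suc-injective e))
    ∈T : ∀ j → T (index′ j) ≡ true
    ∈T zero    = t₀
    ∈T (suc j) = index-∈ E j
    onto : ∀ v → T v ≡ true → ∃ λ j → index′ j ≡ v
    onto zero    _ = zero , refl
    onto (suc v) t with index-onto E v t
    ... | j , e = suc j , cong suc e
  extend false t₀ E = record
    { index = suc ∘ index E
    ; index-injective = index-injective E ∘ suc-injective
    ; index-∈ = index-∈ E
    ; index-onto = onto }
    where
    onto : ∀ v → T v ≡ true → ∃ λ j → suc (index E j) ≡ v
    onto zero t with () ← trans (sym t₀) t
    onto (suc v) t with index-onto E v t
    ... | j , e = j , cong suc e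

anyFin-true : ∀ {n} (f : Fin n → Bool) u → f u ≡ true → anyFin f ≡ true
anyFin-true f zero    e rewrite e = refl
anyFin-true f (suc u) e rewrite anyFin-true (f ∘ suc) u e = ∨-zeroʳ (f zero)

count-complement : ∀ {n} (B : VSet n) → count B + count (not ∘ B) ≡ n
count-complement {zero}  B = refl
count-complement {suc n} B = add-first (B zero) (count-complement (B ∘ suc))
  where
  add-first : ∀ {k l} b → k + l ≡ n →
    (if b then 1 else 0) + k + ((if not b then 1 else 0) + l) ≡ suc n
  add-first {k} {l} true  e = cong suc e
  add-first {k} {l} false e = trans (+-suc k l) (cong suc e)

count-injection≤ : ∀ {m n} (T : VSet n) (f : Fin m → Fin n) →
  Injective _≡_ _≡_ f → (∀ j → T (f j) ≡ true) → m ≤ count T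
count-injection≤ T f f-injective f∈T = injective⇒≤ {f = position} position-injective
  where
  E = enumerate T
  position = λ j → proj₁ (index-onto E (f j) (f∈T j))
  position-injective : Injective _≡_ _≡_ position
  position-injective {i} {j} e = f-injective (begin
    f i                   ≡⟨ sym (proj₂ (index-onto E (f i) (f∈T i))) ⟩
    index E (position i)  ≡⟨ cong (index E) e ⟩
    index E (position j)  ≡⟨ proj₂ (index-onto E (f j) (f∈T j)) ⟩
    f j                   ∎)
    where open ≡-Reasoning

module _ {n} {G : Graph n} where

  LiesIn : ∀ {W} → P2In G W → VSet n → Set
  LiesIn P W′ = ∀ u → OnPath P u → W′ u ≡ true

  Meets : ∀ {W} → P2In G W → VSet n → Set
  Meets P T = ∃ λ u → OnPath P u × T u ≡ true

  Disjoint : ∀ {W W′} → P2In G W → P2In G W′ → Set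
  Disjoint P Q = ∀ u → OnPath P u → OnPath Q u → ⊥

  lies-in-own : ∀ {W} (P : P2In G W) → LiesIn P W
  lies-in-own P u (inj₁ refl)        = xW P
  lies-in-own P u (inj₂ (inj₁ refl)) = yW P
  lies-in-own P u (inj₂ (inj₂ refl)) = zW P

  lies-in : ∀ {W W′} (P : P2In G W) →
    W′ (x P) ≡ true → W′ (y P) ≡ true → W′ (z P) ≡ true → LiesIn P W′
  lies-in P wx wy wz u (inj₁ refl)        = wx
  lies-in P wx wy wz u (inj₂ (inj₁ refl)) = wy
  lies-in P wx wy wz u (inj₂ (inj₂ refl)) = wz

  restrict : ∀ {W W′} (P : P2In G W) → LiesIn P W′ → P2In G W′
  restrict P h = record
    { x = x P ; y = y P ; z = z P ; x≢y = x≢y P ; y≢z = y≢z P ; x≢z = x≢z P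
    ; xy = xy P ; yz = yz P
    ; xW = h (x P) (inj₁ refl) ; yW = h (y P) (inj₂ (inj₁ refl)) ; zW = h (z P) (inj₂ (inj₂ refl)) }

  packing-of-family : ∀ {m W} (T : VSet m) (path : ∀ v → T v ≡ true → P2In G W) →
    (∀ v v′ tv tv′ → v ≢ v′ → Disjoint (path v tv) (path v′ tv′)) → Packing G W (count T)
  packing-of-family T path disjoint =
    (λ j → path (index E j) (index-∈ E j)) ,
    λ i j i≢j → disjoint _ _ _ _ (i≢j ∘ index-injective E)
    where E = enumerate T

  packing-split : ∀ {W W′ k} (T : VSet n) (p : Packing G W k) →
    (∀ i → LiesIn (proj₁ p i) W′ ⊎ Meets (proj₁ p i) T) →
    ∃ λ m → Packing G W′ m × k ≤ m + count T
  packing-split {W} {W′} {k} T (p , p-disjoint) side =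
    count inside , packing-of-family inside within within-disjoint ,
    (begin
      k                                    ≡⟨ sym (count-complement inside) ⟩
      count inside + count (not ∘ inside)  ≤⟨ +-monoʳ-≤ (count inside) outside≤T ⟩
      count inside + count T               ∎)
    where
    open ≤-Reasoning
    inside : VSet k
    inside i = [ const true , const false ]′ (side i)

    lies : ∀ i → inside i ≡ true → LiesIn (p i) W′
    lies i e with side i
    lies i e  | inj₁ l = l
    lies i () | inj₂ _

    meets : ∀ i → not (inside i) ≡ true → Meets (p i) T
    meets i e with side i
    meets i () | inj₁ _
    meets i e  | inj₂ m = m

    within : ∀ i → inside i ≡ true → P2In G W′
    within i e = restrict (p i) (lies i e)

    within-disjoint : ∀ i j ei ej → i ≢ j → Disjoint (within i ei) (within j ej)
    within-disjoint i j _ _ = p-disjoint i j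

    E = enumerate (not ∘ inside)
    witness : Fin (count (not ∘ inside)) → Fin n
    witness j = proj₁ (meets (index E j) (index-∈ E j))

    witness-injective : Injective _≡_ _≡_ witness
    witness-injective {i} {j} e with index E i ≟ index E j
    ... | yes same = index-injective E same
    ... | no  different = ⊥-elim (p-disjoint (index E i) (index E j) different (witness j)
            (subst (OnPath (p (index E i))) e (proj₁ (proj₂ (meets (index E i) (index-∈ E i)))))
            (proj₁ (proj₂ (meets (index E j) (index-∈ E j)))))

    outside≤T : count (not ∘ inside) ≤ count T
    outside≤T = count-injection≤ T witness witness-injective
                  (λ j → proj₂ (proj₂ (meets (index E j) (index-∈ E j))))

  packing-union : ∀ {W₁ W₂ k m} → Packing G W₁ k → Packing G W₂ m →
    (∀ u → W₁ u ≡ true → W₂ u ≡ true → ⊥) → Packing G allV (k + m)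
  packing-union {k = k} (p , p-disjoint) (q , q-disjoint) W₁∩W₂=∅ =
    both , disjoint
    where
    everywhere : ∀ {W} → P2In G W → P2In G allV
    everywhere P = restrict P (λ _ _ → refl)
    both : Fin (k + _) → P2In G allV
    both = (everywhere ∘ p) ++ (everywhere ∘ q)
    disjoint : ∀ i j → i ≢ j → Disjoint (both i) (both j)
    disjoint i j i≢j with splitAt k i in ei | splitAt k j in ej
    ... | inj₁ a | inj₁ b = p-disjoint a b (λ { refl → i≢j (trans (sym (splitAt⁻¹-↑ˡ ei)) (splitAt⁻¹-↑ˡ ej)) })
    ... | inj₁ a | inj₂ b = λ u on-p on-q → W₁∩W₂=∅ u (lies-in-own (p a) u on-p) (lies-in-own (q b) u on-q)
    ... | inj₂ a | inj₁ b = λ u on-q on-p → W₁∩W₂=∅ u (lies-in-own (p b) u on-p) (lies-in-own (q a) u on-q)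
    ... | inj₂ a | inj₂ b = q-disjoint a b (λ { refl → i≢j (trans (sym (splitAt⁻¹-↑ʳ ei)) (splitAt⁻¹-↑ʳ ej)) })

module _ {n} (G : Graph n) (C : VSet n) where

  reach-source-∈ : ∀ {r u} → Reach G C r u → C r ≡ true
  reach-source-∈ (here c)     = c
  reach-source-∈ (step c _ _) = c

  reach-target-∈ : ∀ {r u} → Reach G C r u → C u ≡ true
  reach-target-∈ (here c)     = c
  reach-target-∈ (step _ _ r) = reach-target-∈ r

  reach-trans : ∀ {u v w} → Reach G C u v → Reach G C v w → Reach G C u w
  reach-trans (here _)     r = r
  reach-trans (step c e s) r = step c e (reach-trans s r)

  reach-sym : ∀ {u v} → Reach G C u v → Reach G C v u
  reach-sym (here c) = here c
  reach-sym (step {u} {w} c e r) =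
    reach-trans (reach-sym r) (step (reach-source-∈ r) (trans (Graph.sym G w u) e) (here c))

  ∈C-≢-∉C : ∀ {u v} → C u ≡ true → C v ≡ false → u ≢ v
  ∈C-≢-∉C cu cv refl with () ← trans (sym cu) cv

  nbhd-∉C : ∀ {v} → nbhd G C v ≡ true → C v ≡ false
  nbhd-∉C {v} h with C v
  ... | false = refl

  neighbour-∈-nbhd : ∀ {u v} → C u ≡ true → adj G u v ≡ true → C v ≡ false → nbhd G C v ≡ true
  neighbour-∈-nbhd {u} {v} cu uv cv rewrite cv =
    anyFin-true (λ w → C w ∧ adj G w v) u (cong₂ _∧_ cu uv)

  rest-intro : ∀ {v} → C v ≡ false → nbhd G C v ≡ false → rest G C v ≡ true
  rest-intro cv nv = cong not (cong₂ _∨_ cv nv)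

  ∈C⇒∉rest : ∀ {v} → C v ≡ true → rest G C v ≡ false
  ∈C⇒∉rest cv rewrite cv = refl

  ∈nbhd⇒∉rest : ∀ {v} → nbhd G C v ≡ true → rest G C v ≡ false
  ∈nbhd⇒∉rest {v} nv rewrite nv = cong not (∨-zeroʳ (C v))

  C-closed : ∀ {u v} → C u ≡ true → adj G u v ≡ true → nbhd G C v ≡ false → C v ≡ true
  C-closed cu uv nv = ¬-not λ cv → case trans (sym (neighbour-∈-nbhd cu uv cv)) nv of λ ()

  lies-in-rest-or-meets-nbhd : MaxDeg≤1 G C → ∀ {W} (P : P2In G W) → LiesIn P (rest G C) ⊎ Meets P (nbhd G C)
  lies-in-rest-or-meets-nbhd maxdeg P with nbhd G C (x P) in nx | nbhd G C (y P) in ny | nbhd G C (z P) in nz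
  ... | true  | _     | _     = inj₂ (x P , inj₁ refl , nx)
  ... | false | true  | _     = inj₂ (y P , inj₂ (inj₁ refl) , ny)
  ... | false | false | true  = inj₂ (z P , inj₂ (inj₂ refl) , nz)
  ... | false | false | false =
    inj₁ (lies-in P (rest-intro (end∉C (xy P)) nx) (rest-intro middle∉C ny) (rest-intro (end∉C zy) nz))
    where
    yx : adj G (y P) (x P) ≡ true
    yx = trans (Graph.sym G (y P) (x P)) (xy P)
    zy : adj G (z P) (y P) ≡ true
    zy = trans (Graph.sym G (z P) (y P)) (yz P)

    middle∉C : C (y P) ≡ false
    middle∉C = ¬-not λ cy →
      x≢z P (maxdeg (y P) (x P) (z P) cy (C-closed cy yx nx) (C-closed cy (yz P) nz) yx (yz P))

    end∉C : ∀ {u} → adj G u (y P) ≡ true → C u ≡ false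
    end∉C uy = ¬-not λ cu → case trans (sym (C-closed cu uy ny)) middle∉C of λ ()

  Territory : (Fin n → Fin n) → (Fin n → Fin n) → Fin n → Fin n → Set
  Territory root₁ root₂ v u = u ≡ v ⊎ Reach G C (root₁ v) u ⊎ Reach G C (root₂ v) u

  SeparatedRoots : (Fin n → Fin n) → (Fin n → Fin n) → Set
  SeparatedRoots root₁ root₂ = ∀ v v′ → nbhd G C v ≡ true → nbhd G C v′ ≡ true → v ≢ v′ →
    ¬ Reach G C (root₁ v) (root₁ v′) × ¬ Reach G C (root₁ v) (root₂ v′) ×
    ¬ Reach G C (root₂ v) (root₁ v′) × ¬ Reach G C (root₂ v) (root₂ v′)

  territory-∉rest : ∀ {root₁ root₂ v u} → nbhd G C v ≡ true →
    Territory root₁ root₂ v u → rest G C u ≡ false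
  territory-∉rest nv (inj₁ refl)     = ∈nbhd⇒∉rest nv
  territory-∉rest nv (inj₂ (inj₁ r)) = ∈C⇒∉rest (reach-target-∈ r)
  territory-∉rest nv (inj₂ (inj₂ r)) = ∈C⇒∉rest (reach-target-∈ r)

  territories-disjoint : ∀ {root₁ root₂} → SeparatedRoots root₁ root₂ →
    ∀ {v v′ u} → nbhd G C v ≡ true → nbhd G C v′ ≡ true → v ≢ v′ →
    Territory root₁ root₂ v u → Territory root₁ root₂ v′ u → ⊥
  territories-disjoint {root₁} {root₂} sep {v} {v′} nv nv′ v≢v′ = disjoint
    where
    unreached : ∀ {w r} → nbhd G C w ≡ true → Reach G C r w → ⊥
    unreached nw r = ∈C-≢-∉C (reach-target-∈ r) (nbhd-∉C nw) refl
    across : ∀ {r r′ u} → ¬ Reach G C r r′ → Reach G C r u → Reach G C r′ u → ⊥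
    across apart r r′ = apart (reach-trans r (reach-sym r′))
    disjoint : ∀ {u} → Territory root₁ root₂ v u → Territory root₁ root₂ v′ u → ⊥
    disjoint (inj₁ refl)     (inj₁ e)         = v≢v′ e
    disjoint (inj₁ refl)     (inj₂ r)         = [ unreached nv , unreached nv ]′ r
    disjoint (inj₂ r)        (inj₁ refl)      = [ unreached nv′ , unreached nv′ ]′ r
    disjoint (inj₂ (inj₁ r)) (inj₂ (inj₁ r′)) = across (proj₁ (sep v v′ nv nv′ v≢v′)) r r′
    disjoint (inj₂ (inj₁ r)) (inj₂ (inj₂ r′)) = across (proj₁ (proj₂ (sep v v′ nv nv′ v≢v′))) r r′
    disjoint (inj₂ (inj₂ r)) (inj₂ (inj₁ r′)) = across (proj₁ (proj₂ (proj₂ (sep v v′ nv nv′ v≢v′)))) r r′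
    disjoint (inj₂ (inj₂ r)) (inj₂ (inj₂ r′)) = across (proj₂ (proj₂ (proj₂ (sep v v′ nv nv′ v≢v′)))) r r′

  -- Condition (i) is the case root₁ = root₂ of an edge component.
  record Gadgets : Set where
    field
      root₁ root₂ : Fin n → Fin n
      separated   : SeparatedRoots root₁ root₂
      gadget      : ∀ v → nbhd G C v ≡ true →
                    Σ (P2In G allV) λ P → ∀ u → OnPath P u → Territory root₁ root₂ v u

  gadget-packing : Gadgets → Packing G (not ∘ rest G C) (count (nbhd G C))
  gadget-packing Γ = packing-of-family (nbhd G C) placed disjoint
    where
    open Gadgets Γ
    placed : ∀ v → nbhd G C v ≡ true → P2In G (not ∘ rest G C)
    placed v nv = restrict (proj₁ (gadget v nv)) λ u on →
      cong not (territory-∉rest {root₁} {root₂} nv (proj₂ (gadget v nv) u on))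
    disjoint : ∀ v v′ nv nv′ → v ≢ v′ → Disjoint (placed v nv) (placed v′ nv′)
    disjoint v v′ nv nv′ v≢v′ u on on′ =
      territories-disjoint {root₁} {root₂} separated nv nv′ v≢v′
        (proj₂ (gadget v nv) u on) (proj₂ (gadget v′ nv′) u on′)

  path₃ : ∀ {a b c} → a ≢ b → b ≢ c → a ≢ c → adj G a b ≡ true → adj G b c ≡ true → P2In G allV
  path₃ {a} {b} {c} a≢b b≢c a≢c ab bc = record
    { x = a ; y = b ; z = c ; x≢y = a≢b ; y≢z = b≢c ; x≢z = a≢c ; xy = ab ; yz = bc
    ; xW = refl ; yW = refl ; zW = refl }

  edge-component-adjacent : ∀ {r a b} → Reach G C r a → Reach G C r b → a ≢ b →
    (∀ w → Reach G C r w → w ≡ a ⊎ w ≡ b) → adj G a b ≡ true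
  edge-component-adjacent {a = a} ra rb a≢b only-a-b = first-step (reach-trans (reach-sym ra) rb)
    where
    first-step : Reach G C a _ → adj G a _ ≡ true
    first-step (here _) = ⊥-elim (a≢b refl)
    first-step (step {w = w} ca aw wb) with only-a-b w (reach-trans ra (step ca aw (here (reach-source-∈ wb))))
    ... | inj₁ refl with () ← trans (sym aw) (irrefl G a)
    ... | inj₂ refl = aw

  edge-component-partner : ∀ {r w} → EdgeComp G C r → Reach G C r w →
    ∃ λ w′ → w ≢ w′ × adj G w w′ ≡ true × Reach G C r w′
  edge-component-partner {w = w} (a , b , a≢b , only-a-b , ra , rb) rw with only-a-b w rw
  ... | inj₁ refl = b , a≢b , edge-component-adjacent ra rb a≢b only-a-b , rb
  ... | inj₂ refl = a , a≢b ∘ sym ,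
        trans (Graph.sym G b a) (edge-component-adjacent ra rb a≢b only-a-b) , ra

  gadgets-I : CondI G C → Gadgets
  gadgets-I (root , component , separate) = record
    { root₁ = root ; root₂ = root
    ; separated = λ v v′ nv nv′ v≢v′ → let s = separate v v′ nv nv′ v≢v′ in s , s , s , s
    ; gadget = gadget }
    where
    gadget : ∀ v → nbhd G C v ≡ true → Σ (P2In G allV) λ P → ∀ u → OnPath P u → Territory root root v u
    gadget v nv with component v nv
    ... | _ , edge , w , rw , vw with edge-component-partner edge rw
    ... | w′ , w≢w′ , ww′ , rw′ =
      path₃ (∈C-≢-∉C (reach-target-∈ rw) v∉C ∘ sym) w≢w′ (∈C-≢-∉C (reach-target-∈ rw′) v∉C ∘ sym) vw ww′ ,
      λ { u (inj₁ refl)        → inj₁ refl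
        ; u (inj₂ (inj₁ refl)) → inj₂ (inj₁ rw)
        ; u (inj₂ (inj₂ refl)) → inj₂ (inj₁ rw′) }
      where v∉C = nbhd-∉C nv

  gadgets-II : CondII G C → Gadgets
  gadgets-II (root₁ , root₂ , components , separated) = record
    { root₁ = root₁ ; root₂ = root₂ ; separated = separated ; gadget = gadget }
    where
    gadget : ∀ v → nbhd G C v ≡ true → Σ (P2In G allV) λ P → ∀ u → OnPath P u → Territory root₁ root₂ v u
    gadget v nv with components v nv
    ... | _ , _ , (w₁ , r₁ , vw₁) , (w₂ , r₂ , vw₂) , apart =
      path₃ (∈C-≢-∉C (reach-target-∈ r₁) v∉C) (∈C-≢-∉C (reach-target-∈ r₂) v∉C ∘ sym)
        (λ { refl → apart (reach-trans r₁ (reach-sym r₂)) }) (trans (Graph.sym G w₁ v) vw₁) vw₂ ,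
      λ { u (inj₁ refl)        → inj₂ (inj₁ r₁)
        ; u (inj₂ (inj₁ refl)) → inj₁ refl
        ; u (inj₂ (inj₂ refl)) → inj₂ (inj₂ r₂) }
      where v∉C = nbhd-∉C nv

lemma1 : ∀ {n} (G : Graph n) (C : VSet n) → Reducible G C →
    ∀ (a b : ℕ) → IsOpt G allV a → IsOpt G (rest G C) b →
    a ≡ b + count (nbhd G C)
lemma1 G C (maxdeg , condition) a b (packing-a , a-maximum) (packing-b , b-maximum) =
  ≤-antisym upper lower
  where
  upper : a ≤ b + count (nbhd G C)
  upper with packing-split (nbhd G C) packing-a (lies-in-rest-or-meets-nbhd G C maxdeg ∘ proj₁ packing-a)
  ... | m , packing-m , a≤m+N = ≤-trans a≤m+N (+-monoˡ-≤ (count (nbhd G C)) (b-maximum m packing-m))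

  gadgets : Gadgets G C
  gadgets = [ gadgets-I G C , gadgets-II G C ]′ condition

  lower : b + count (nbhd G C) ≤ a
  lower = subst (_≤ a) (+-comm (count (nbhd G C)) b)
    (a-maximum _ (packing-union (gadget-packing G C gadgets) packing-b disjoint))
    where
    disjoint : ∀ u → not (rest G C u) ≡ true → rest G C u ≡ true → ⊥
    disjoint u e r with () ← trans (sym e) (cong not r)
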